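{- Let $G$ be a finite simple graph with at least one edge. Then a proper coloring of $G$ is Connected-compelling if and only if it is CDom-compelling.
   Context: A proper coloring partitions $V(G)$ into nonempty independent color classes; a rainbow committee (RC) is a set consisting of exactly one vertex of each color. A proper coloring compels a property if every RC has that property. Property Connected: the subgraph induced by the RC is connected. Property CDom: the RC is a connected dominating set of $G$, i.e. it induces a connected subgraph and every vertex not in the RC has a neighbor in the RC. -}

module Defs where

open import Data.Nat using (ℕ; suc)
open import Data.Fin using (Fin)
open import Data.Product using (Σ; ∃; _×_; _,_)
open import Relation.Binary.PropositionalEquality using (_≡_; _≢_)
open import Relation.Nullary using (¬_)
open import Level using (0ℓ; suc)

record Graph (n : ℕ) : Set₁ where
  field
    Adj   : Fin n → Fin n → Set
    irrefl : ∀ {u} → ¬ Adj u u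
    sym    : ∀ {u v} → Adj u v → Adj v u
open Graph public

module _ {n : ℕ} (G : Graph n) where

  HasEdge : Set
  HasEdge = Σ (Fin n) λ u → Σ (Fin n) λ v → Adj G u v

  data WalkIn (S : Fin n → Set) : Fin n → Fin n → Set where
    here : ∀ {u} → S u → WalkIn S u u
    step : ∀ {u w v} → S u → Adj G u w → WalkIn S w v → WalkIn S u v

  InducedConnected : (Fin n → Set) → Set
  InducedConnected S = ∀ u v → S u → S v → WalkIn S u v

  Dominating : (Fin n → Set) → Set
  Dominating S = ∀ v → ¬ S v → Σ (Fin n) λ u → S u × Adj G v u

  ConnectedDominating : (Fin n → Set) → Set
  ConnectedDominating S = InducedConnected S × Dominating S

  record ProperColoring (k : ℕ) : Set₁ where
    field
      col      : Fin n → Fin k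
      onto     : ∀ (i : Fin k) → Σ (Fin n) λ v → col v ≡ i
      proper   : ∀ {u v} → Adj G u v → col u ≢ col v
  open ProperColoring public

  module _ {k : ℕ} (c : ProperColoring k) where

    RainbowCommittee : Set
    RainbowCommittee = Σ (Fin k → Fin n) λ r → ∀ i → col c (r i) ≡ i

    members : RainbowCommittee → Fin n → Set
    members (r , _) v = Σ (Fin k) λ i → r i ≡ v

    Compels : ((Fin n → Set) → Set) → Set
    Compels P = ∀ (R : RainbowCommittee) → P (members R)

    ConnectedCompelling : Set
    ConnectedCompelling = Compels InducedConnected

    CDomCompelling : Set
    CDomCompelling = Compels ConnectedDominating

-- If every rainbow committee induces a connected subgraph, then every vertex v
-- has a neighbour in every committee R: swap v into R as the representative of
-- its own colour, and walk inside the new committee from v to the representative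
-- of some other colour (one exists because G has an edge).  The first step of
-- that walk leaves v's colour class, so it lands on a vertex of R.

module Submission where

open import Defs
open import Data.Nat using (ℕ)
open import Data.Fin using (Fin; _≟_)
open import Data.Vec.Functional using (updateAt)
open import Data.Vec.Functional.Properties using (updateAt-updates; updateAt-minimal)
open import Data.Product using (Σ; _×_; _,_; proj₁)
open import Function using (const)
open import Relation.Nullary using (yes; no; contradiction)
open import Relation.Binary.PropositionalEquality
  using (_≡_; _≢_; refl; trans; cong) renaming (sym to ≡-sym)

module _ {n : ℕ} (G : Graph n) where

  walkIn-source : ∀ {S u v} → WalkIn G S u v → S u
  walkIn-source (here s)     = s
  walkIn-source (step s _ _) = s

  walkIn-firstStep : ∀ {S u v} → WalkIn G S u v → u ≢ v →
                     Σ (Fin n) λ w → S w × Adj G u w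
  walkIn-firstStep (here _)             u≢u = contradiction refl u≢u
  walkIn-firstStep (step {w = w} _ a p) _   = w , walkIn-source p , a

  module _ {k : ℕ} (c : ProperColoring G k) where

    anotherColour : HasEdge G → (i : Fin k) → Σ (Fin k) λ j → j ≢ i
    anotherColour (u , v , uv) i with col c u ≟ i
    ... | yes refl = col c v , λ cv≡cu → proper c uv (≡-sym cv≡cu)
    ... | no cu≢i  = col c u , cu≢i

    swapIn : RainbowCommittee G c → Fin n → RainbowCommittee G c
    swapIn (r , rainbow) v = updateAt r (col c v) (const v) , rainbow′
      where
      rainbow′ : ∀ i → col c (updateAt r (col c v) (const v) i) ≡ i
      rainbow′ i with i ≟ col c v
      ... | yes refl = cong (col c) (updateAt-updates i r)
      ... | no i≢cv  = trans (cong (col c) (updateAt-minimal i (col c v) r i≢cv)) (rainbow i)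

    swapIn-contains : ∀ R v → members G c (swapIn R v) v
    swapIn-contains (r , _) v = col c v , updateAt-updates (col c v) r

    colour-of-member : ∀ (R : RainbowCommittee G c) {i w} → proj₁ R i ≡ w → col c w ≡ i
    colour-of-member (r , rainbow) {i} ri≡w = trans (cong (col c) (≡-sym ri≡w)) (rainbow i)

    swapIn-neighbour : ∀ R v {w} → Adj G v w → members G c (swapIn R v) w → members G c R w
    swapIn-neighbour R@(r , _) v {w} vw (i , r′i≡w) =
      i , trans (≡-sym (updateAt-minimal i (col c v) r i≢cv)) r′i≡w
      where
      i≢cv : i ≢ col c v
      i≢cv i≡cv = proper c vw (≡-sym (trans (colour-of-member (swapIn R v) r′i≡w) i≡cv))

    neighbourInCommittee : HasEdge G → ConnectedCompelling G c →
                           ∀ R v → Σ (Fin n) λ w → members G c R w × Adj G v w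
    neighbourInCommittee e connected R v with anotherColour e (col c v)
    ... | j , j≢cv with walkIn-firstStep (connected R′ v rj (swapIn-contains R v) (j , refl)) v≢rj
      where
      R′ = swapIn R v
      rj = proj₁ R′ j
      v≢rj : v ≢ rj
      v≢rj v≡rj = j≢cv (≡-sym (colour-of-member R′ (≡-sym v≡rj)))
    ... | w , w∈R′ , vw = w , swapIn-neighbour R v vw w∈R′ , vw

mainTheorem12 : ∀ {n k : ℕ} (G : Graph n) → HasEdge G → (c : ProperColoring G k) →
    (ConnectedCompelling G c → CDomCompelling G c) × (CDomCompelling G c → ConnectedCompelling G c)
mainTheorem12 G e c =
  (λ connected R → connected R , λ v _ → neighbourInCommittee G c e connected R v) ,
  (λ cdom R → proj₁ (cdom R))
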